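{- Let $\bar x=\bigsqcup_{i\in I}\bar x_i$ be a partition of $\bar x=\{x_1,\dots,x_n\}$, let $\mathrm{char}(\mathbb{F})=0$ or $\mathrm{char}(\mathbb{F})=p>|I|$, and let $\beta\in\mathbb{F}\setminus\{0,1,\dots,|I|\}$. If $f\in\mathbb{F}[\bar x]$ is multilinear and $$f(\bar x)\Big(\sum_{i\in I}\prod_{x\in\bar x_i}(1-x)-\beta\Big)=1\pmod{\bar x^2-\bar x},$$ then $\deg f=n$.
   Context: "mod $\bar x^2-\bar x$" means modulo the ideal generated by $x_i^2-x_i$, $i\in[n]$. -}

module Defs where

open import Level using (_⊔_)
open import Algebra.Bundles using (CommutativeRing)
open import Data.Nat as ℕ using (ℕ; zero; suc; _<_)
open import Data.Bool using (Bool; true; false; if_then_else_)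
open import Data.Fin using (Fin)
open import Data.Fin.Subset using (Subset; _∪_; ∣_∣; ⊥; ⊤; ⁅_⁆)
open import Data.Vec using (Vec; []; _∷_)
open import Data.Vec.Properties using (≡-dec)
open import Data.Bool.Properties using () renaming (_≟_ to _≟ᵇ_)
open import Data.List using (List; []; _∷_; _++_; map; foldr; filterᵇ)
open import Data.List.Base using (allFin)
open import Data.Product using (Σ; _×_; ∃)
open import Data.Sum using (_⊎_)
open import Relation.Binary.PropositionalEquality using (_≡_)
open import Relation.Nullary using (¬_)
open import Relation.Nullary.Decidable using (⌊_⌋)
open import Data.Fin.Properties using () renaming (_≟_ to _≟ᶠ_)

allSubsets : ∀ n → List (Subset n)
allSubsets zero = [] ∷ []
allSubsets (suc n) = map (true ∷_) (allSubsets n) ++ map (false ∷_) (allSubsets n)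

_≟ˢ_ : ∀ {n} (S T : Subset n) → _
_≟ˢ_ = ≡-dec _≟ᵇ_

module _ {c ℓ} (R : CommutativeRing c ℓ) where
  open CommutativeRing R

  IsField : Set (c ⊔ ℓ)
  IsField = (¬ (1# ≈ 0#)) × (∀ a → ¬ (a ≈ 0#) → Σ Carrier λ b → a * b ≈ 1#)

  ι : ℕ → Carrier
  ι zero = 0#
  ι (suc k) = 1# + ι k

  HasCharacteristic : ℕ → Set ℓ
  HasCharacteristic ch =
      (ch ≡ 0 × (∀ k → ¬ (ι (suc k) ≈ 0#)))
    ⊎ (0 < ch × ι ch ≈ 0# × (∀ k → 0 < k → k < ch → ¬ (ι k ≈ 0#)))

  sumL : List Carrier → Carrier
  sumL = foldr _+_ 0#

  -- Multilinear polynomials in x₁..xₙ, identified with F[x̄]/(x̄²−x̄):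
  -- P S is the coefficient of the monomial ∏_{i∈S} xᵢ.
  MPoly : ℕ → Set c
  MPoly n = Subset n → Carrier

  constP : ∀ {n} → Carrier → MPoly n
  constP a S = if ⌊ S ≟ˢ ⊥ ⌋ then a else 0#

  varP : ∀ {n} → Fin n → MPoly n
  varP i S = if ⌊ S ≟ˢ ⁅ i ⁆ ⌋ then 1# else 0#

  _+P_ : ∀ {n} → MPoly n → MPoly n → MPoly n
  (P +P Q) S = P S + Q S

  -P_ : ∀ {n} → MPoly n → MPoly n
  (-P P) S = - (P S)

  _-P_ : ∀ {n} → MPoly n → MPoly n → MPoly n
  P -P Q = P +P (-P Q)

  -- product modulo x̄² − x̄ : x_S · x_T = x_{S∪T}
  _*P_ : ∀ {n} → MPoly n → MPoly n → MPoly n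
  _*P_ {n} P Q U = sumL (Data.List.concatMap (λ S → map (λ T →
      if ⌊ (S ∪ T) ≟ˢ U ⌋ then P S * Q T else 0#) (allSubsets n)) (allSubsets n))

  sumP : ∀ {n} → List (MPoly n) → MPoly n
  sumP = foldr _+P_ (constP 0#)

  prodP : ∀ {n} → List (MPoly n) → MPoly n
  prodP = foldr _*P_ (constP 1#)

  _≈P_ : ∀ {n} → MPoly n → MPoly n → Set ℓ
  P ≈P Q = ∀ S → P S ≈ Q S

  HasDegree : ∀ {n} → MPoly n → ℕ → Set ℓ
  HasDegree P d = (Σ (Subset _) λ S → ∣ S ∣ ≡ d × ¬ (P S ≈ 0#))
                × (∀ S → ¬ (P S ≈ 0#) → ∣ S ∣ ℕ.≤ d)

  -- Σ_{i∈I} ∏_{x∈x̄ᵢ} (1 − x) − β, for the partition given by blk : Fin n → Fin m (I = Fin m)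
  blockPoly : ∀ {n m} → (Fin n → Fin m) → Carrier → MPoly n
  blockPoly {n} {m} blk β =
    sumP (map (λ i → prodP (map (λ j → constP 1# -P varP j)
                                (filterᵇ (λ j → ⌊ blk j ≟ᶠ i ⌋) (allFin n))))
              (allFin m))
    -P constP β

-- Evaluating at the 0/1-points a turns the hypothesis into f(a)·(g(a) − β) = 1, where
-- g(a) is the number of blocks on which a vanishes, so f(a) = 1/(m − d(a) − β) with d(a)
-- the number of blocks hit by a.  The top coefficient of a multilinear polynomial is the
-- alternating sum of its values over the cube; grouping the cube by blocks, this sum is
-- ± the k-th forward difference of d ↦ 1/(m − d − β) at 0, where k ≤ m is the number of
-- nonempty blocks.  That difference equals k!/∏_{j≤k}(m − j − β), which is nonzero since
-- the characteristic exceeds m and β ∉ {0,…,m}.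
module Submission where

open import Defs
open import Algebra.Bundles using (CommutativeRing)
open import Data.Nat using (ℕ; _<_; _≤_)
open import Data.Fin using (Fin)
open import Data.Product using (Σ; _×_)
open import Data.Sum using (_⊎_)
open import Relation.Binary.PropositionalEquality using (_≡_)
open import Relation.Nullary using (¬_)
open import Function.Definitions using (Surjective)

open import Data.Bool using (Bool; true; false; if_then_else_; _∧_; _∨_; not)
open import Data.Bool.Properties using (∧-comm; ∨-zeroʳ)
open import Data.Nat as ℕ using (zero; suc; _∸_; _!)
open import Data.Nat.Properties as ℕ using (+-suc; ∸-+-assoc; m∸n+n≡m; m∸n≤m; m+n≤o⇒m≤o; m+n≤o⇒m≤o∸n; ≤-trans; n≤1+n; <-irrefl; ≤-<-trans)
open import Data.Fin using (zero; suc)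
open import Data.Fin.Properties using (_≟_; suc-injective)
open import Data.Fin.Subset using (Subset; _∪_; ∣_∣; ∁; ⊥; ⊤; ⁅_⁆)
open import Data.Fin.Subset.Properties using (∣p∣≤n; ∣⊤∣≡n; ∣⊥∣≡0; ∣∁p∣≡n∸∣p∣; ∪-identityˡ)
open import Data.Vec using ([]; _∷_; lookup)
open import Data.Vec.Properties using (lookup-replicate; lookup-zipWith)
open import Data.List using (List; []; _∷_; _++_; map; foldr; concatMap; filterᵇ; tabulate; allFin)
open import Data.Bool.ListAction using (or; any)
open import Data.List.Properties using (map-∘; map-++; map-tabulate)
open import Data.Product using (_,_; proj₁; proj₂)
open import Data.Sum using (inj₁; inj₂)
open import Data.Maybe using (nothing)
open import Data.Empty using (⊥-elim)
open import Function using (_∘_; id)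
import Relation.Binary.PropositionalEquality as ≡
open import Relation.Nullary.Decidable using (⌊_⌋; isYes≗does; ⌊⌋-map′)
open import Tactic.RingSolver.Core.AlmostCommutativeRing using (fromCommutativeRing)

-- Subsets of variables and of blocks

module _ where
  open ≡ using (refl; sym; trans; cong; cong₂)

  ∨-swap : ∀ x y z → x ∨ (y ∨ z) ≡ y ∨ (x ∨ z)
  ∨-swap true  y z = sym (∨-zeroʳ y)
  ∨-swap false y z = refl

  ≟ˢ-∷ : ∀ {n} x (S T : Subset n) → ⌊ (x ∷ S) ≟ˢ (x ∷ T) ⌋ ≡ ⌊ S ≟ˢ T ⌋
  ≟ˢ-∷ false S T = trans (isYes≗does _) (sym (isYes≗does (S ≟ˢ T)))
  ≟ˢ-∷ true  S T = trans (isYes≗does _) (sym (isYes≗does (S ≟ˢ T)))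

  if-≟ˢ-∷ : ∀ {a} {A : Set a} {n} x (S T : Subset n) (u v : A) →
    (if ⌊ (x ∷ S) ≟ˢ (x ∷ T) ⌋ then u else v) ≡ (if ⌊ S ≟ˢ T ⌋ then u else v)
  if-≟ˢ-∷ x S T u v = cong (if_then u else v) (≟ˢ-∷ x S T)

  lookup-⁅⁆ : ∀ {m} (b i : Fin m) → lookup ⁅ b ⁆ i ≡ ⌊ b ≟ i ⌋
  lookup-⁅⁆ zero    zero    = refl
  lookup-⁅⁆ zero    (suc i) = lookup-replicate i false
  lookup-⁅⁆ (suc b) zero    = refl
  lookup-⁅⁆ (suc b) (suc i) = trans (lookup-⁅⁆ b i) (sym (⌊⌋-map′ (cong suc) suc-injective (b ≟ i)))

  ⁅⁆∪-absorb : ∀ {m} (D : Subset m) b → lookup D b ≡ true → ⁅ b ⁆ ∪ D ≡ D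
  ⁅⁆∪-absorb (true ∷ D) zero    refl = cong (true ∷_) (∪-identityˡ D)
  ⁅⁆∪-absorb (d ∷ D)    (suc b) Db   = cong (d ∷_) (⁅⁆∪-absorb D b Db)

  ∣⁅⁆∪∣ : ∀ {m} (D : Subset m) b → lookup D b ≡ false → ∣ ⁅ b ⁆ ∪ D ∣ ≡ suc ∣ D ∣
  ∣⁅⁆∪∣ (false ∷ D) zero    refl = cong (suc ∘ ∣_∣) (∪-identityˡ D)
  ∣⁅⁆∪∣ (true ∷ D)  (suc b) Db   = cong suc (∣⁅⁆∪∣ D b Db)
  ∣⁅⁆∪∣ (false ∷ D) (suc b) Db   = ∣⁅⁆∪∣ D b Db

  m∸e≡m∸[j+e]+j : ∀ {m} j e → j ℕ.+ e ≤ m → m ∸ e ≡ (m ∸ (j ℕ.+ e)) ℕ.+ j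
  m∸e≡m∸[j+e]+j {m} j e j+e≤m = sym (trans (cong (ℕ._+ j) (trans (cong (m ∸_) (ℕ.+-comm j e)) (sym (∸-+-assoc m e j))))
                                          (m∸n+n≡m (m+n≤o⇒m≤o∸n j j+e≤m)))

  meets : ∀ {m} → Subset m → Subset m → Bool
  meets []      []      = false
  meets (s ∷ S) (d ∷ D) = (s ∧ d) ∨ meets S D

  meets-comm : ∀ {m} (S D : Subset m) → meets S D ≡ meets D S
  meets-comm []      []      = refl
  meets-comm (s ∷ S) (d ∷ D) = cong₂ _∨_ (∧-comm s d) (meets-comm S D)

  meets-⊥ˡ : ∀ {m} (D : Subset m) → meets ⊥ D ≡ false
  meets-⊥ˡ []      = refl
  meets-⊥ˡ (d ∷ D) = meets-⊥ˡ D

  meets-⊥ʳ : ∀ {m} (S : Subset m) → meets S ⊥ ≡ false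
  meets-⊥ʳ S = trans (meets-comm S ⊥) (meets-⊥ˡ S)

  meets-⁅⁆∪ʳ : ∀ {m} (S D : Subset m) b → meets S (⁅ b ⁆ ∪ D) ≡ lookup S b ∨ meets S D
  meets-⁅⁆∪ʳ (true ∷ S)  (d ∷ D) zero    = refl
  meets-⁅⁆∪ʳ (false ∷ S) (d ∷ D) zero    = cong (meets S) (∪-identityˡ D)
  meets-⁅⁆∪ʳ (s ∷ S)     (d ∷ D) (suc b) =
    trans (cong ((s ∧ d) ∨_) (meets-⁅⁆∪ʳ S D b)) (∨-swap (s ∧ d) (lookup S b) (meets S D))

  meets-⁅⁆∪ˡ : ∀ {m} (S D : Subset m) b → meets (⁅ b ⁆ ∪ S) D ≡ lookup D b ∨ meets S D
  meets-⁅⁆∪ˡ S D b = trans (meets-comm _ D)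
    (trans (meets-⁅⁆∪ʳ D S b) (cong (lookup D b ∨_) (meets-comm D S)))

  hits : ∀ {n m} → (Fin n → Fin m) → Subset n → Subset m
  hits blk []          = ⊥
  hits blk (false ∷ a) = hits (blk ∘ suc) a
  hits blk (true ∷ a)  = ⁅ blk zero ⁆ ∪ hits (blk ∘ suc) a

  lookup-hits : ∀ {n m} (blk : Fin n → Fin m) a i →
    lookup (hits blk a) i ≡ or (tabulate λ j → lookup a j ∧ ⌊ blk j ≟ i ⌋)
  lookup-hits blk []          i = lookup-replicate i false
  lookup-hits blk (false ∷ a) i = lookup-hits (blk ∘ suc) a i
  lookup-hits blk (true ∷ a)  i = trans (lookup-zipWith _∨_ i ⁅ blk zero ⁆ (hits (blk ∘ suc) a))
    (cong₂ _∨_ (lookup-⁅⁆ (blk zero) i) (lookup-hits (blk ∘ suc) a i))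

module _ {c ℓ} (F : CommutativeRing c ℓ) where
  open CommutativeRing F hiding (zero)
  open import Algebra.Properties.Ring ring using (-0#≈0#; -‿involutive; -‿+-comm; x∙y⁻¹≈ε⇒x≈y; xyx⁻¹≈y; [y-z]x≈yx-zx; x[y-z]≈xy-xz)
  open import Algebra.Properties.CommutativeSemigroup *-commutativeSemigroup using (x∙yz≈xz∙y)
  open import Algebra.Properties.Semiring.Mult semiring using (×-homo-+; ×1-homo-*) renaming (_×_ to _×ᴿ_)
  open import Relation.Binary.Reasoning.Setoid setoid
  open import Tactic.RingSolver.NonReflective (fromCommutativeRing F (λ _ → nothing))
    using (solve; _⊕_; _⊗_; ⊝_; _⊜_)

  private
    +-interchange : ∀ a b c d → (a + b) + (c + d) ≈ (a + c) + (b + d)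
    +-interchange = solve 4 (λ a b c d → ((a ⊕ b) ⊕ (c ⊕ d)) ⊜ ((a ⊕ c) ⊕ (b ⊕ d))) refl

    [x+y-z]-[x-z]≈y : ∀ x y z → ((x + y) - z) - (x - z) ≈ y
    [x+y-z]-[x-z]≈y x y z = trans (+-congʳ (x+y-z≈x-z+y x y z)) (xyx⁻¹≈y (x - z) y)
      where
      x+y-z≈x-z+y : ∀ x y z → (x + y) - z ≈ (x - z) + y
      x+y-z≈x-z+y = solve 3 (λ x y z → ((x ⊕ y) ⊕ ⊝ z) ⊜ ((x ⊕ ⊝ z) ⊕ y)) refl

    0+0+[0+x]≈x : ∀ x → (0# + 0#) + (0# + x) ≈ x
    0+0+[0+x]≈x x = trans (+-congʳ (+-identityˡ 0#)) (trans (+-identityˡ _) (+-identityˡ x))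

    expand-* : ∀ p₀ p₁ q₀ q₁ → p₀ * q₀ + ((p₁ * q₁ + p₁ * q₀) + p₀ * q₁) ≈ (p₀ + p₁) * (q₀ + q₁)
    expand-* = solve 4 (λ p₀ p₁ q₀ q₁ →
      (p₀ ⊗ q₀ ⊕ ((p₁ ⊗ q₁ ⊕ p₁ ⊗ q₀) ⊕ p₀ ⊗ q₁)) ⊜ ((p₀ ⊕ p₁) ⊗ (q₀ ⊕ q₁))) refl

  infixl 7 _·_
  _·_ : ∀ {n} → MPoly F n → MPoly F n → MPoly F n
  _·_ = _*P_ F

  ind : Bool → Carrier
  ind b = if b then 1# else 0#

  1-ind : ∀ b → 1# - ind b ≈ ind (not b)
  1-ind true  = -‿inverseʳ 1#
  1-ind false = trans (+-congˡ -0#≈0#) (+-identityʳ 1#)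

  ι≡×1 : ∀ k → ι F k ≡ k ×ᴿ 1#
  ι≡×1 zero    = ≡.refl
  ι≡×1 (suc k) = ≡.cong (1# +_) (ι≡×1 k)

  ι-+ : ∀ j k → ι F (j ℕ.+ k) ≈ ι F j + ι F k
  ι-+ j k rewrite ι≡×1 (j ℕ.+ k) | ι≡×1 j | ι≡×1 k = ×-homo-+ 1# j k

  ι-* : ∀ j k → ι F (j ℕ.* k) ≈ ι F j * ι F k
  ι-* j k rewrite ι≡×1 (j ℕ.* k) | ι≡×1 j | ι≡×1 k = ×1-homo-* j k

  ι-∸-+ : ∀ {m} j e → j ℕ.+ e ≤ m → ι F (m ∸ e) ≈ ι F (m ∸ (j ℕ.+ e)) + ι F j
  ι-∸-+ {m} j e j+e≤m = trans (reflexive (≡.cong (ι F) (m∸e≡m∸[j+e]+j j e j+e≤m))) (ι-+ (m ∸ (j ℕ.+ e)) j)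

  *-inverse-unique : ∀ {x y z} → x * z ≈ 1# → y * z ≈ 1# → x ≈ y
  *-inverse-unique {x} {y} {z} xz≈1 yz≈1 = begin
    x             ≈⟨ *-identityʳ x ⟨
    x * 1#        ≈⟨ *-congˡ yz≈1 ⟨
    x * (y * z)   ≈⟨ *-congˡ (*-comm y z) ⟩
    x * (z * y)   ≈⟨ *-assoc x z y ⟨
    (x * z) * y   ≈⟨ *-congʳ xz≈1 ⟩
    1# * y        ≈⟨ *-identityˡ y ⟩
    y             ∎

  sumOver : ∀ {a} {X : Set a} → List X → (X → Carrier) → Carrier
  sumOver xs φ = sumL F (map φ xs)

  prodOver : ∀ {a} {X : Set a} → List X → (X → Carrier) → Carrier
  prodOver xs φ = foldr _*_ 1# (map φ xs)

  sumL-++ : ∀ (xs ys : List Carrier) → sumL F (xs ++ ys) ≈ sumL F xs + sumL F ys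
  sumL-++ []       ys = sym (+-identityˡ _)
  sumL-++ (x ∷ xs) ys = trans (+-congˡ (sumL-++ xs ys)) (sym (+-assoc _ _ _))

  module _ {a} {X : Set a} where

    sumOver-cong : ∀ {φ ψ : X → Carrier} → (∀ x → φ x ≈ ψ x) → ∀ xs → sumOver xs φ ≈ sumOver xs ψ
    sumOver-cong φ≈ψ []       = refl
    sumOver-cong φ≈ψ (x ∷ xs) = +-cong (φ≈ψ x) (sumOver-cong φ≈ψ xs)

    prodOver-cong : ∀ {φ ψ : X → Carrier} → (∀ x → φ x ≈ ψ x) → ∀ xs → prodOver xs φ ≈ prodOver xs ψ
    prodOver-cong φ≈ψ []       = refl
    prodOver-cong φ≈ψ (x ∷ xs) = *-cong (φ≈ψ x) (prodOver-cong φ≈ψ xs)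

    sumOver-+ : ∀ (φ ψ : X → Carrier) xs → sumOver xs (λ x → φ x + ψ x) ≈ sumOver xs φ + sumOver xs ψ
    sumOver-+ φ ψ []       = sym (+-identityˡ _)
    sumOver-+ φ ψ (x ∷ xs) = trans (+-congˡ (sumOver-+ φ ψ xs)) (+-interchange _ _ _ _)

    sumOver-0 : ∀ (xs : List X) → sumOver xs (λ _ → 0#) ≈ 0#
    sumOver-0 []       = refl
    sumOver-0 (x ∷ xs) = trans (+-congˡ (sumOver-0 xs)) (+-identityˡ 0#)

    sumL-concatMap : ∀ (f : X → List Carrier) xs → sumL F (concatMap f xs) ≈ sumOver xs (sumL F ∘ f)
    sumL-concatMap f []       = refl
    sumL-concatMap f (x ∷ xs) = trans (sumL-++ (f x) (concatMap f xs)) (+-congˡ (sumL-concatMap f xs))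

    prodOver-filter : ∀ (p q : X → Bool) xs →
      prodOver (filterᵇ p xs) (λ x → ind (not (q x))) ≈ ind (not (any (λ x → q x ∧ p x) xs))
    prodOver-filter p q []       = refl
    prodOver-filter p q (x ∷ xs) with p x | q x in qx
    ... | true  | true  = trans (*-congʳ (reflexive (≡.cong (ind ∘ not) qx))) (zeroˡ _)
    ... | true  | false = trans (*-congʳ (reflexive (≡.cong (ind ∘ not) qx)))
                                (trans (*-identityˡ _) (prodOver-filter p q xs))
    ... | false | true  = prodOver-filter p q xs
    ... | false | false = prodOver-filter p q xs

  sumOver-allSubsets : ∀ {n} (φ : Subset (suc n) → Carrier) →
    sumOver (allSubsets (suc n)) φ ≈ sumOver (allSubsets n) (φ ∘ (true ∷_)) + sumOver (allSubsets n) (φ ∘ (false ∷_))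
  sumOver-allSubsets {n} φ = begin
    sumL F (map φ (map (true ∷_) (allSubsets n) ++ map (false ∷_) (allSubsets n)))
      ≡⟨ ≡.cong (sumL F) (map-++ φ (map (true ∷_) (allSubsets n)) _) ⟩
    sumL F (map φ (map (true ∷_) (allSubsets n)) ++ map φ (map (false ∷_) (allSubsets n)))
      ≈⟨ sumL-++ (map φ (map (true ∷_) (allSubsets n))) _ ⟩
    sumL F (map φ (map (true ∷_) (allSubsets n))) + sumL F (map φ (map (false ∷_) (allSubsets n)))
      ≡⟨ ≡.sym (≡.cong₂ _+_ (≡.cong (sumL F) (map-∘ (allSubsets n))) (≡.cong (sumL F) (map-∘ (allSubsets n)))) ⟩
    sumOver (allSubsets n) (φ ∘ (true ∷_)) + sumOver (allSubsets n) (φ ∘ (false ∷_)) ∎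

  -- Multilinear polynomials on the Boolean cube

  sum² : ∀ {n} → (Subset n → Subset n → Carrier) → Carrier
  sum² {n} H = sumOver (allSubsets n) λ S → sumOver (allSubsets n) (H S)

  sum²-cong : ∀ {n} {H K : Subset n → Subset n → Carrier} → (∀ S T → H S T ≈ K S T) → sum² H ≈ sum² K
  sum²-cong {n} H≈K = sumOver-cong (λ S → sumOver-cong (H≈K S) (allSubsets n)) (allSubsets n)

  sum²-0 : ∀ n → sum² {n} (λ _ _ → 0#) ≈ 0#
  sum²-0 n = trans (sumOver-cong (λ _ → sumOver-0 (allSubsets n)) (allSubsets n)) (sumOver-0 (allSubsets n))

  sum²-suc : ∀ {n} (H : Subset (suc n) → Subset (suc n) → Carrier) →
    sum² H ≈ (sum² (λ S T → H (true ∷ S) (true ∷ T)) + sum² (λ S T → H (true ∷ S) (false ∷ T)))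
           + (sum² (λ S T → H (false ∷ S) (true ∷ T)) + sum² (λ S T → H (false ∷ S) (false ∷ T)))
  sum²-suc {n} H = trans (sumOver-allSubsets (λ S → sumOver (allSubsets (suc n)) (H S))) (+-cong (split true) (split false))
    where
    split : ∀ x → sumOver (allSubsets n) (λ S → sumOver (allSubsets (suc n)) (H (x ∷ S)))
                ≈ sum² (λ S T → H (x ∷ S) (true ∷ T)) + sum² (λ S T → H (x ∷ S) (false ∷ T))
    split x = trans (sumOver-cong (λ S → sumOver-allSubsets (H (x ∷ S))) (allSubsets n)) (sumOver-+ _ _ (allSubsets n))

  coeffTerm : ∀ {n} → MPoly F n → MPoly F n → Subset n → Subset n → Subset n → Carrier
  coeffTerm P Q U S T = if ⌊ (S ∪ T) ≟ˢ U ⌋ then P S * Q T else 0#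

  *P-coeff : ∀ {n} (P Q : MPoly F n) U → (P · Q) U ≈ sum² (coeffTerm P Q U)
  *P-coeff {n} P Q U = sumL-concatMap _ (allSubsets n)

  coeffTerm-∷ : ∀ {n} (P Q : MPoly F (suc n)) x y U S T →
    coeffTerm P Q ((x ∨ y) ∷ U) (x ∷ S) (y ∷ T) ≡ coeffTerm (λ S → P (x ∷ S)) (λ T → Q (y ∷ T)) U S T
  coeffTerm-∷ P Q x y U S T = if-≟ˢ-∷ (x ∨ y) (S ∪ T) U _ _

  -- P = part₀ P + x₀ · part₁ P
  part₀ part₁ : ∀ {n} → MPoly F (suc n) → MPoly F n
  part₀ P S = P (false ∷ S)
  part₁ P S = P (true ∷ S)

  module _ {n} (P Q : MPoly F (suc n)) (U : Subset n) where
    private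
      coeffTerm-part : ∀ x y → sum² (λ S T → coeffTerm P Q ((x ∨ y) ∷ U) (x ∷ S) (y ∷ T))
                             ≈ ((λ S → P (x ∷ S)) · (λ T → Q (y ∷ T))) U
      coeffTerm-part x y = trans (sum²-cong (λ S T → reflexive (coeffTerm-∷ P Q x y U S T))) (sym (*P-coeff _ _ U))

    *P-part₀ : (P · Q) (false ∷ U) ≈ (part₀ P · part₀ Q) U
    *P-part₀ = trans (*P-coeff P Q (false ∷ U)) (trans (sum²-suc (coeffTerm P Q (false ∷ U)))
      (trans (+-cong (+-cong (sum²-0 n) (sum²-0 n)) (+-cong (sum²-0 n) (coeffTerm-part false false)))
             (0+0+[0+x]≈x _)))

    *P-part₁ : (P · Q) (true ∷ U) ≈
      ((part₁ P · part₁ Q) U + (part₁ P · part₀ Q) U) + (part₀ P · part₁ Q) U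
    *P-part₁ = trans (*P-coeff P Q (true ∷ U)) (trans (sum²-suc (coeffTerm P Q (true ∷ U)))
      (trans (+-cong (+-cong (coeffTerm-part true true) (coeffTerm-part true false))
                     (+-cong (coeffTerm-part false true) (sum²-0 n)))
             (+-congˡ (+-identityʳ _))))

  -- eval P a is the value of P at the 0/1-point whose coordinates are the entries of a.
  eval : ∀ {n} → MPoly F n → Subset n → Carrier
  eval {zero}  P []          = P []
  eval {suc n} P (false ∷ a) = eval (part₀ P) a
  eval {suc n} P (true ∷ a)  = eval (part₀ P) a + eval (part₁ P) a

  eval-cong : ∀ {n} {P Q : MPoly F n} → _≈P_ F P Q → ∀ a → eval P a ≈ eval Q a
  eval-cong {zero}  P≈Q []          = P≈Q []
  eval-cong {suc n} P≈Q (false ∷ a) = eval-cong (P≈Q ∘ (false ∷_)) a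
  eval-cong {suc n} P≈Q (true ∷ a)  = +-cong (eval-cong (P≈Q ∘ (false ∷_)) a) (eval-cong (P≈Q ∘ (true ∷_)) a)

  eval-0 : ∀ {n} a → eval {n} (λ _ → 0#) a ≈ 0#
  eval-0 {zero}  []          = refl
  eval-0 {suc n} (false ∷ a) = eval-0 a
  eval-0 {suc n} (true ∷ a)  = trans (+-cong (eval-0 a) (eval-0 a)) (+-identityˡ 0#)

  eval-+ : ∀ {n} (P Q : MPoly F n) a → eval (_+P_ F P Q) a ≈ eval P a + eval Q a
  eval-+ {zero}  P Q []          = refl
  eval-+ {suc n} P Q (false ∷ a) = eval-+ (part₀ P) (part₀ Q) a
  eval-+ {suc n} P Q (true ∷ a)  =
    trans (+-cong (eval-+ (part₀ P) (part₀ Q) a) (eval-+ (part₁ P) (part₁ Q) a)) (+-interchange _ _ _ _)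

  eval-neg : ∀ {n} (P : MPoly F n) a → eval (-P_ F P) a ≈ - eval P a
  eval-neg {zero}  P []          = refl
  eval-neg {suc n} P (false ∷ a) = eval-neg (part₀ P) a
  eval-neg {suc n} P (true ∷ a)  =
    trans (+-cong (eval-neg (part₀ P) a) (eval-neg (part₁ P) a)) (-‿+-comm _ _)

  eval-* : ∀ {n} (P Q : MPoly F n) a → eval (P · Q) a ≈ eval P a * eval Q a
  eval-* {zero}  P Q []          = +-identityʳ _
  eval-* {suc n} P Q (false ∷ a) = trans (eval-cong (*P-part₀ P Q) a) (eval-* (part₀ P) (part₀ Q) a)
  eval-* {suc n} P Q (true ∷ a)  = begin
    eval (part₀ (P · Q)) a + eval (part₁ (P · Q)) a
      ≈⟨ +-cong (eval-cong (*P-part₀ P Q) a) (eval-cong (*P-part₁ P Q) a) ⟩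
    eval (P₀ · Q₀) a + eval (_+P_ F (_+P_ F (P₁ · Q₁) (P₁ · Q₀)) (P₀ · Q₁)) a
      ≈⟨ +-congˡ (trans (eval-+ _ _ a) (+-congʳ (eval-+ _ _ a))) ⟩
    eval (P₀ · Q₀) a + ((eval (P₁ · Q₁) a + eval (P₁ · Q₀) a) + eval (P₀ · Q₁) a)
      ≈⟨ +-cong (eval-* P₀ Q₀ a) (+-cong (+-cong (eval-* P₁ Q₁ a) (eval-* P₁ Q₀ a)) (eval-* P₀ Q₁ a)) ⟩
    eval P₀ a * eval Q₀ a + ((eval P₁ a * eval Q₁ a + eval P₁ a * eval Q₀ a) + eval P₀ a * eval Q₁ a)
      ≈⟨ expand-* _ _ _ _ ⟩
    (eval P₀ a + eval P₁ a) * (eval Q₀ a + eval Q₁ a) ∎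
    where
    P₀ = part₀ P; P₁ = part₁ P; Q₀ = part₀ Q; Q₁ = part₁ Q

  part₀-constP : ∀ {n} x → _≈P_ F (part₀ (constP F x)) (constP F {n} x)
  part₀-constP x S = reflexive (if-≟ˢ-∷ false S ⊥ x 0#)

  part₁-varP-zero : ∀ {n} → _≈P_ F (part₁ (varP F zero)) (constP F {n} 1#)
  part₁-varP-zero S = reflexive (if-≟ˢ-∷ true S ⊥ 1# 0#)

  part₀-varP-suc : ∀ {n} (j : Fin n) → _≈P_ F (part₀ (varP F (suc j))) (varP F j)
  part₀-varP-suc j S = reflexive (if-≟ˢ-∷ false S ⁅ j ⁆ 1# 0#)

  eval-const : ∀ {n} x a → eval {n} (constP F x) a ≈ x
  eval-const {zero}  x []          = refl
  eval-const {suc n} x (false ∷ a) = trans (eval-cong (part₀-constP x) a) (eval-const x a)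
  eval-const {suc n} x (true ∷ a)  =
    trans (+-cong (trans (eval-cong (part₀-constP x) a) (eval-const x a)) (eval-0 a)) (+-identityʳ x)

  eval-var : ∀ {n} (j : Fin n) a → eval (varP F j) a ≈ ind (lookup a j)
  eval-var zero    (false ∷ a) = eval-0 a
  eval-var zero    (true ∷ a)  =
    trans (+-cong (eval-0 a) (trans (eval-cong part₁-varP-zero a) (eval-const 1# a))) (+-identityˡ 1#)
  eval-var (suc j) (false ∷ a) = trans (eval-cong (part₀-varP-suc j) a) (eval-var j a)
  eval-var (suc j) (true ∷ a)  =
    trans (+-cong (trans (eval-cong (part₀-varP-suc j) a) (eval-var j a)) (eval-0 a)) (+-identityʳ _)

  eval-1-var : ∀ {n} (j : Fin n) a → eval (_-P_ F (constP F 1#) (varP F j)) a ≈ ind (not (lookup a j))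
  eval-1-var j a = begin
    eval (_-P_ F (constP F 1#) (varP F j)) a     ≈⟨ eval-+ _ _ a ⟩
    eval (constP F 1#) a + eval (-P_ F (varP F j)) a ≈⟨ +-cong (eval-const 1# a) (trans (eval-neg _ a) (-‿cong (eval-var j a))) ⟩
    1# - ind (lookup a j)                         ≈⟨ 1-ind (lookup a j) ⟩
    ind (not (lookup a j))                        ∎

  eval-sumP : ∀ {a n} {X : Set a} (Φ : X → MPoly F n) xs b →
    eval (sumP F (map Φ xs)) b ≈ sumOver xs (λ x → eval (Φ x) b)
  eval-sumP Φ []       b = eval-const 0# b
  eval-sumP Φ (x ∷ xs) b = trans (eval-+ _ _ b) (+-congˡ (eval-sumP Φ xs b))

  eval-prodP : ∀ {a n} {X : Set a} (Φ : X → MPoly F n) xs b →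
    eval (prodP F (map Φ xs)) b ≈ prodOver xs (λ x → eval (Φ x) b)
  eval-prodP Φ []       b = eval-const 1# b
  eval-prodP Φ (x ∷ xs) b = trans (eval-* _ _ b) (*-congˡ (eval-prodP Φ xs b))

  -- altSum V = Σ_a (−1)^(n − |a|) V a
  altSum : ∀ {n} → (Subset n → Carrier) → Carrier
  altSum {zero}  V = V []
  altSum {suc n} V = altSum λ a → V (true ∷ a) - V (false ∷ a)

  altSum-cong : ∀ {n} {V W : Subset n → Carrier} → (∀ a → V a ≈ W a) → altSum V ≈ altSum W
  altSum-cong {zero}  V≈W = V≈W []
  altSum-cong {suc n} V≈W = altSum-cong λ a → +-cong (V≈W (true ∷ a)) (-‿cong (V≈W (false ∷ a)))

  altSum-neg : ∀ {n} (V : Subset n → Carrier) → altSum (λ a → - V a) ≈ - altSum V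
  altSum-neg {zero}  V = refl
  altSum-neg {suc n} V = trans (altSum-cong λ a → -‿+-comm (V (true ∷ a)) (- V (false ∷ a)))
    (altSum-neg λ a → V (true ∷ a) - V (false ∷ a))

  coeff⊤≈altSum-eval : ∀ {n} (P : MPoly F n) → P ⊤ ≈ altSum (eval P)
  coeff⊤≈altSum-eval {zero}  P = refl
  coeff⊤≈altSum-eval {suc n} P =
    trans (coeff⊤≈altSum-eval (part₁ P)) (altSum-cong λ a → sym (xyx⁻¹≈y (eval (part₀ P) a) _))

  sum-ind-∁ : ∀ {m} (D : Subset m) → sumL F (tabulate λ i → ind (not (lookup D i))) ≈ ι F ∣ ∁ D ∣
  sum-ind-∁ []          = refl
  sum-ind-∁ (true ∷ D)  = trans (+-identityˡ _) (sum-ind-∁ D)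
  sum-ind-∁ (false ∷ D) = +-congˡ (sum-ind-∁ D)

  eval-blockFactor : ∀ {n m} (blk : Fin n → Fin m) a i →
    eval (prodP F (map (λ j → _-P_ F (constP F 1#) (varP F j)) (filterᵇ (λ j → ⌊ blk j ≟ i ⌋) (allFin n)))) a
      ≈ ind (not (lookup (hits blk a) i))
  eval-blockFactor {n} blk a i = begin
    eval (prodP F (map oneMinus (filterᵇ inBlock (allFin n)))) a     ≈⟨ eval-prodP oneMinus (filterᵇ inBlock (allFin n)) a ⟩
    prodOver (filterᵇ inBlock (allFin n)) (λ j → eval (oneMinus j) a) ≈⟨ prodOver-cong (λ j → eval-1-var j a) (filterᵇ inBlock (allFin n)) ⟩
    prodOver (filterᵇ inBlock (allFin n)) (λ j → ind (not (lookup a j)))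
      ≈⟨ prodOver-filter inBlock (lookup a) (allFin n) ⟩
    ind (not (any (λ j → lookup a j ∧ inBlock j) (allFin n)))
      ≡⟨ ≡.cong (ind ∘ not) (≡.trans (≡.cong or (map-tabulate id (λ j → lookup a j ∧ inBlock j))) (≡.sym (lookup-hits blk a i))) ⟩
    ind (not (lookup (hits blk a) i))                               ∎
    where
    oneMinus : Fin n → MPoly F n
    oneMinus j = _-P_ F (constP F 1#) (varP F j)
    inBlock : Fin n → Bool
    inBlock j = ⌊ blk j ≟ i ⌋

  eval-blockPoly : ∀ {n m} (blk : Fin n → Fin m) β a →
    eval (blockPoly F blk β) a ≈ ι F (m ∸ ∣ hits blk a ∣) - β
  eval-blockPoly {n} {m} blk β a = begin
    eval (blockPoly F blk β) a                                        ≈⟨ eval-+ _ _ a ⟩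
    eval (sumP F (map _ (allFin m))) a + eval (-P_ F (constP F β)) a
      ≈⟨ +-cong (eval-sumP _ (allFin m) a) (trans (eval-neg _ a) (-‿cong (eval-const β a))) ⟩
    sumOver (allFin m) _ - β                ≈⟨ +-congʳ (sumOver-cong (eval-blockFactor blk a) (allFin m)) ⟩
    sumOver (allFin m) (λ i → ind (not (lookup D i))) - β
      ≡⟨ ≡.cong (λ s → sumL F s - β) (map-tabulate id (λ i → ind (not (lookup D i)))) ⟩
    sumL F (tabulate λ i → ind (not (lookup D i))) - β               ≈⟨ +-congʳ (sum-ind-∁ D) ⟩
    ι F ∣ ∁ D ∣ - β                         ≡⟨ ≡.cong (λ k → ι F k - β) (∣∁p∣≡n∸∣p∣ D) ⟩
    ι F (m ∸ ∣ D ∣) - β                     ∎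
    where
    D = hits blk a

  eval-inverse-blockPoly : ∀ {n m} (blk : Fin n → Fin m) β (f : MPoly F n) →
    _≈P_ F (f · blockPoly F blk β) (constP F 1#) → ∀ a → eval f a * (ι F (m ∸ ∣ hits blk a ∣) - β) ≈ 1#
  eval-inverse-blockPoly {m = m} blk β f f·g≈1 a = begin
    eval f a * (ι F (m ∸ ∣ hits blk a ∣) - β) ≈⟨ *-congˡ (eval-blockPoly blk β a) ⟨
    eval f a * eval (blockPoly F blk β) a     ≈⟨ eval-* f _ a ⟨
    eval (f · blockPoly F blk β) a            ≈⟨ eval-cong f·g≈1 a ⟩
    eval (constP F 1#) a                      ≈⟨ eval-const 1# a ⟩
    1#                                        ∎

  -- The alternating sum over the cube, grouped by blocks

  δ : ∀ {m} → Fin m → (Subset m → Carrier) → Subset m → Carrier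
  δ b H D = H (⁅ b ⁆ ∪ D) - H D

  diff : (ℕ → Carrier) → ℕ → Carrier
  diff φ d = φ (suc d) - φ d

  diff^ : ℕ → (ℕ → Carrier) → ℕ → Carrier
  diff^ zero    φ = φ
  diff^ (suc k) φ = diff (diff^ k φ)

  diff^-diff : ∀ k φ d → diff^ k (diff φ) d ≈ diff^ (suc k) φ d
  diff^-diff zero    φ d = refl
  diff^-diff (suc k) φ d = +-cong (diff^-diff k φ (suc d)) (-‿cong (diff^-diff k φ d))

  -- Shape of the integrand once the blocks in S have been differenced out.
  guarded : ∀ {m} → Subset m → (ℕ → Carrier) → Subset m → Carrier
  guarded S φ D = if meets S D then 0# else φ ∣ D ∣

  δ-guarded-∈ : ∀ {m} (S : Subset m) b φ → lookup S b ≡ true → ∀ D → δ b (guarded S φ) D ≈ - guarded S φ D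
  δ-guarded-∈ S b φ Sb D rewrite meets-⁅⁆∪ʳ S D b | Sb = +-identityˡ _

  δ-guarded-∉ : ∀ {m} (S : Subset m) b φ → lookup S b ≡ false →
    ∀ D → δ b (guarded S φ) D ≈ guarded (⁅ b ⁆ ∪ S) (diff φ) D
  δ-guarded-∉ S b φ Sb D rewrite meets-⁅⁆∪ˡ S D b with lookup D b in Db
  ... | true  rewrite ⁅⁆∪-absorb D b Db = -‿inverseʳ _
  ... | false rewrite meets-⁅⁆∪ʳ S D b | Sb | ∣⁅⁆∪∣ D b Db with meets S D
  ...   | true  = -‿inverseʳ 0#
  ...   | false = refl

  infix 4 _≈±_
  _≈±_ : Carrier → Carrier → Set ℓ
  x ≈± y = x ≈ y ⊎ x ≈ - y

  ≈±-neg : ∀ {x y} → x ≈± y → - x ≈± y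
  ≈±-neg (inj₁ x≈y)  = inj₂ (-‿cong x≈y)
  ≈±-neg (inj₂ x≈-y) = inj₁ (trans (-‿cong x≈-y) (-‿involutive _))

  ≈±-respˡ : ∀ {x x′ y} → x ≈ x′ → x′ ≈± y → x ≈± y
  ≈±-respˡ x≈x′ (inj₁ e) = inj₁ (trans x≈x′ e)
  ≈±-respˡ x≈x′ (inj₂ e) = inj₂ (trans x≈x′ e)

  ≈±-respʳ : ∀ {x y y′} → x ≈± y → y ≈ y′ → x ≈± y′
  ≈±-respʳ (inj₁ e) y≈y′ = inj₁ (trans e y≈y′)
  ≈±-respʳ (inj₂ e) y≈y′ = inj₂ (trans e (-‿cong y≈y′))

  ≈±-≉0 : ∀ {x y} → x ≈± y → ¬ y ≈ 0# → ¬ x ≈ 0#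
  ≈±-≉0 (inj₁ x≈y)  y≉0 x≈0 = y≉0 (trans (sym x≈y) x≈0)
  ≈±-≉0 (inj₂ x≈-y) y≉0 x≈0 =
    y≉0 (trans (sym (-‿involutive _)) (trans (-‿cong (trans (sym x≈-y) x≈0)) -0#≈0#))

  altSum-guarded-hits : ∀ {n m} (blk : Fin n → Fin m) (S : Subset m) (φ : ℕ → Carrier) →
    Σ ℕ λ k → k ℕ.+ ∣ S ∣ ≤ m × altSum (guarded S φ ∘ hits blk) ≈± diff^ k φ 0
  altSum-guarded-hits {zero} {m} blk S φ =
    0 , ∣p∣≤n S , inj₁ (reflexive (≡.cong₂ (λ b d → if b then 0# else φ d) (meets-⊥ʳ S) (∣⊥∣≡0 m)))
  -- Here altSum (H ∘ hits blk) unfolds to altSum (δ (blk zero) H ∘ hits (blk ∘ suc)).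
  altSum-guarded-hits {suc n} {m} blk S φ with lookup S (blk zero) in Sb
  ... | true  = let k , k+∣S∣≤m , r = altSum-guarded-hits (blk ∘ suc) S φ in
    k , k+∣S∣≤m , ≈±-respˡ (trans (altSum-cong (δ-guarded-∈ S (blk zero) φ Sb ∘ hits (blk ∘ suc)))
                                 (altSum-neg (guarded S φ ∘ hits (blk ∘ suc)))) (≈±-neg r)
  ... | false = let k , k+∣S′∣≤m , r = altSum-guarded-hits (blk ∘ suc) (⁅ blk zero ⁆ ∪ S) (diff φ) in
    suc k , ≡.subst (_≤ m) (≡.trans (≡.cong (k ℕ.+_) (∣⁅⁆∪∣ S (blk zero) Sb)) (+-suc k ∣ S ∣)) k+∣S′∣≤m ,
    ≈±-respʳ (≈±-respˡ (altSum-cong (δ-guarded-∉ S (blk zero) φ Sb ∘ hits (blk ∘ suc))) r) (diff^-diff k φ 0)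

  -- Iterated differences of reciprocals

  module ReciprocalDifferences {m : ℕ} (ψ φ : ℕ → Carrier)
    (φψ≈1 : ∀ d → φ d * ψ d ≈ 1#)
    (ψ-step : ∀ j e → j ℕ.+ e ≤ m → ψ e - ψ (j ℕ.+ e) ≈ ι F j) where

    ∏ψ : ℕ → ℕ → Carrier
    ∏ψ zero    e = ψ e
    ∏ψ (suc k) e = ψ e * ∏ψ k (suc e)

    ∏ψ-snoc : ∀ k e → ∏ψ (suc k) e ≈ ∏ψ k e * ψ (suc k ℕ.+ e)
    ∏ψ-snoc zero    e = refl
    ∏ψ-snoc (suc k) e = begin
      ψ e * ∏ψ (suc k) (suc e)                   ≈⟨ *-congˡ (∏ψ-snoc k (suc e)) ⟩
      ψ e * (∏ψ k (suc e) * ψ (suc k ℕ.+ suc e)) ≈⟨ *-assoc _ _ _ ⟨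
      ∏ψ (suc k) e * ψ (suc k ℕ.+ suc e)         ≡⟨ ≡.cong (λ d → ∏ψ (suc k) e * ψ d) (+-suc (suc k) e) ⟩
      ∏ψ (suc k) e * ψ (suc (suc k) ℕ.+ e)       ∎

    diff^*∏ψ : ∀ k e → k ℕ.+ e ≤ m → diff^ k φ e * ∏ψ k e ≈ ι F (k !)
    diff^*∏ψ zero    e _  = trans (φψ≈1 e) (sym (+-identityʳ 1#))
    diff^*∏ψ (suc k) e le = begin
      (Δ (suc e) - Δ e) * ∏ψ (suc k) e                           ≈⟨ [y-z]x≈yx-zx _ _ _ ⟩
      Δ (suc e) * ∏ψ (suc k) e - Δ e * ∏ψ (suc k) e              ≈⟨ +-cong upper (-‿cong lower) ⟩
      ι F (k !) * ψ e - ι F (k !) * ψ (suc k ℕ.+ e)              ≈⟨ x[y-z]≈xy-xz _ _ _ ⟨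
      ι F (k !) * (ψ e - ψ (suc k ℕ.+ e))                         ≈⟨ *-congˡ (ψ-step (suc k) e le) ⟩
      ι F (k !) * ι F (suc k)                                     ≈⟨ *-comm _ _ ⟩
      ι F (suc k) * ι F (k !)                                     ≈⟨ ι-* (suc k) (k !) ⟨
      ι F (suc k !)                                               ∎
      where
      Δ = diff^ k φ
      upper : Δ (suc e) * ∏ψ (suc k) e ≈ ι F (k !) * ψ e
      upper = trans (x∙yz≈xz∙y _ _ _) (*-congʳ (diff^*∏ψ k (suc e) (≡.subst (_≤ m) (≡.sym (+-suc k e)) le)))
      lower : Δ e * ∏ψ (suc k) e ≈ ι F (k !) * ψ (suc k ℕ.+ e)
      lower = trans (*-congˡ (∏ψ-snoc k e)) (trans (sym (*-assoc _ _ _)) (*-congʳ (diff^*∏ψ k e (≤-trans (n≤1+n _) le))))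

    diff^-≉0 : ∀ k → k ≤ m → ¬ ι F (k !) ≈ 0# → ¬ diff^ k φ 0 ≈ 0#
    diff^-≉0 k k≤m k!≉0 Δ≈0 =
      k!≉0 (trans (sym (diff^*∏ψ k 0 (≡.subst (_≤ m) (≡.sym (ℕ.+-comm k 0)) k≤m))) (trans (*-congʳ Δ≈0) (zeroˡ _)))

  module _ (isField : IsField F) where

    *-≉0 : ∀ {x y} → ¬ x ≈ 0# → ¬ y ≈ 0# → ¬ x * y ≈ 0#
    *-≉0 {x} {y} x≉0 y≉0 xy≈0 = y≉0 (begin
      y               ≈⟨ *-identityˡ y ⟨
      1# * y          ≈⟨ *-congʳ (trans (sym x*x⁻¹≈1) (*-comm x x⁻¹)) ⟩
      (x⁻¹ * x) * y   ≈⟨ *-assoc _ _ _ ⟩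
      x⁻¹ * (x * y)   ≈⟨ *-congˡ xy≈0 ⟩
      x⁻¹ * 0#        ≈⟨ zeroʳ _ ⟩
      0#              ∎)
      where
      x⁻¹ = proj₁ (proj₂ isField x x≉0)
      x*x⁻¹≈1 = proj₂ (proj₂ isField x x≉0)

    ι-!-≉0 : ∀ {m} → (∀ k → 0 < k → k ≤ m → ¬ ι F k ≈ 0#) → ∀ k → k ≤ m → ¬ ι F (k !) ≈ 0#
    ι-!-≉0 ι≉0 zero    _   = proj₁ isField ∘ trans (sym (+-identityʳ 1#))
    ι-!-≉0 ι≉0 (suc k) k<m = *-≉0 (ι≉0 (suc k) (ℕ.s≤s ℕ.z≤n) k<m) (ι-!-≉0 ι≉0 k (≤-trans (n≤1+n k) k<m))
                             ∘ trans (sym (ι-* (suc k) (k !)))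

    coeff⊤-≉0 : ∀ {n m} (blk : Fin n → Fin m) → (∀ k → 0 < k → k ≤ m → ¬ ι F k ≈ 0#) →
      (β : Carrier) → (∀ k → k ≤ m → ¬ β ≈ ι F k) →
      (f : MPoly F n) → _≈P_ F (f · blockPoly F blk β) (constP F 1#) → ¬ f ⊤ ≈ 0#
    coeff⊤-≉0 {n} {m} blk ι≉0 β β≉ι f f·g≈1 f⊤≈0 = ≈±-≉0 r (diff^-≉0 k k≤m (ι-!-≉0 ι≉0 k k≤m)) (begin
      altSum (guarded ⊥ φ ∘ hits blk) ≈⟨ altSum-cong (λ a → trans (eval-f a) (reflexive (≡.sym (unguard a)))) ⟨
      altSum (eval f)                 ≈⟨ coeff⊤≈altSum-eval f ⟨
      f ⊤                             ≈⟨ f⊤≈0 ⟩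
      0#                              ∎)
      where
      ψ : ℕ → Carrier
      ψ d = ι F (m ∸ d) - β
      ψ≉0 : ∀ d → ¬ ψ d ≈ 0#
      ψ≉0 d ψ≈0 = β≉ι (m ∸ d) (m∸n≤m m d) (sym (x∙y⁻¹≈ε⇒x≈y _ _ ψ≈0))
      φ : ℕ → Carrier
      φ d = proj₁ (proj₂ isField (ψ d) (ψ≉0 d))
      φψ≈1 : ∀ d → φ d * ψ d ≈ 1#
      φψ≈1 d = trans (*-comm _ _) (proj₂ (proj₂ isField (ψ d) (ψ≉0 d)))
      ψ-step : ∀ j e → j ℕ.+ e ≤ m → ψ e - ψ (j ℕ.+ e) ≈ ι F j
      ψ-step j e j+e≤m = trans (+-congʳ (+-congʳ (ι-∸-+ j e j+e≤m))) ([x+y-z]-[x-z]≈y _ _ _)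
      open ReciprocalDifferences ψ φ φψ≈1 ψ-step
      eval-f : ∀ a → eval f a ≈ φ ∣ hits blk a ∣
      eval-f a = *-inverse-unique (eval-inverse-blockPoly blk β f f·g≈1 a) (φψ≈1 ∣ hits blk a ∣)
      unguard : ∀ a → guarded ⊥ φ (hits blk a) ≡ φ ∣ hits blk a ∣
      unguard a = ≡.cong (if_then 0# else φ ∣ hits blk a ∣) (meets-⊥ˡ (hits blk a))
      k = proj₁ (altSum-guarded-hits blk ⊥ φ)
      k≤m : k ≤ m
      k≤m = m+n≤o⇒m≤o k (proj₁ (proj₂ (altSum-guarded-hits blk ⊥ φ)))
      r = proj₂ (proj₂ (altSum-guarded-hits blk ⊥ φ))

ι≉0-below-char : ∀ {c ℓ} (F : CommutativeRing c ℓ) {m ch} → HasCharacteristic F ch → (ch ≡ 0 ⊎ m < ch) →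
  ∀ k → 0 < k → k ≤ m → ¬ CommutativeRing._≈_ F (ι F k) (CommutativeRing.0# F)
ι≉0-below-char F (inj₁ (_ , ι≉0))      _             (suc k) _   _   = ι≉0 k
ι≉0-below-char F (inj₂ (0<ch , _ , _)) (inj₁ ≡.refl) k       _   _   = ⊥-elim (<-irrefl ≡.refl 0<ch)
ι≉0-below-char F (inj₂ (_ , _ , ι≉0))  (inj₂ m<ch)   k       0<k k≤m = ι≉0 k 0<k (≤-<-trans k≤m m<ch)

corollary3p3 : ∀ {c ℓ} (F : CommutativeRing c ℓ) → IsField F →
    (n m : ℕ) (blk : Fin n → Fin m) → Surjective _≡_ _≡_ blk →
    (Σ ℕ λ ch → HasCharacteristic F ch × (ch ≡ 0 ⊎ m < ch)) →
    (β : CommutativeRing.Carrier F) →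
    (∀ k → k ≤ m → ¬ (CommutativeRing._≈_ F β (ι F k))) →
    (f : MPoly F n) →
    _≈P_ F (_*P_ F f (blockPoly F blk β)) (constP F (CommutativeRing.1# F)) →
    HasDegree F f n
corollary3p3 F isField n m blk _ (ch , char , ch-big) β β≉ι f f*g≈1 =
  (⊤ , ∣⊤∣≡n n , coeff⊤-≉0 F isField blk (ι≉0-below-char F char ch-big) β β≉ι f f*g≈1) ,
  (λ S _ → ∣p∣≤n S)
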